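{- The algorithm Maj has competitive function $\frac{n}{2}$.
   Context: Online frequent items problem: an input sequence is $I=a_1,\ldots,a_n$ of items from an infinite universe, $n=|I|$, revealed one at a time. An algorithm maintains a buffer holding one item; $s_t$ is the buffer content after step $t$; at step $1$ the buffer receives $a_1$, and at each later step $t$ the algorithm either keeps $s_{t-1}$ or replaces it by $a_t$. With $f_I(a)=|\{i:a_i=a\}|/n$, the aggregate frequency of $\mathcal A$ on $I$ is $\mathcal A(I)=\sum_{t=1}^n f_I(s^{\mathcal A}_t)$ (to be maximized). Opt denotes an optimal offline algorithm (knows all of $I$ in advance, same buffer rules). Maj keeps a counter, initially $0$: when an item arrives, if the counter is $0$ it buffers the item and sets the counter to $1$; otherwise, if the arriving item equals the buffered item the counter is incremented, else it is decremented (buffer unchanged). Competitive function: $\mathcal A$ is $f(n)$-competitive if there is $h\in o(f)$ such that for all $I$ (with $n=|I|$), $\mathrm{Opt}(I)\le (f(n)+h(n))\,\mathcal A(I)$. $\mathcal A$ has competitive function $f(n)$ if it is $f(n)$-competitive and for every $g(n)$ such that $\mathcal A$ is $g(n)$-competitive, $\lim_{n\to\infty} f(n)/g(n)\le 1$.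
   Formalization: The functions g(n) and h(n) in the definitions of g(n)-competitiveness and of competitive function take rational values. -}

module Defs where

open import Data.Nat as ℕ using (ℕ; zero; suc; _≟_)
open import Data.Integer using (+_)
open import Data.List using (List; []; _∷_; map; _++_; length; foldr)
open import Data.Nat.ListAction using (sum)
open import Data.Product using (Σ; _×_; ∃; ∃-syntax)
open import Relation.Nullary using (yes; no)
open import Data.Rational using (ℚ; _/_; 0ℚ; 1ℚ; _≤_; _<_; _*_; _+_; ∣_∣; _⊔_)

-- Items are drawn from the infinite universe ℕ; an input is a list of items.
-- A "run" of an algorithm on input I is the list s_1, ..., s_n of buffer contents.

occ : ℕ → List ℕ → ℕ
occ a [] = 0
occ a (x ∷ xs) with a ≟ x
... | yes _ = suc (occ a xs)
... | no  _ = occ a xs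

-- k / m as a rational, with the convention k / 0 = 0 (only used for the empty input)
ratio : ℕ → ℕ → ℚ
ratio k zero = 0ℚ
ratio k (suc m) = (+ k) / suc m

freq : List ℕ → ℕ → ℚ
freq I a = ratio (occ a I) (length I)

-- aggregate frequency of buffer sequence s on input I: Σ_t f_I(s_t)
aggregate : List ℕ → List ℕ → ℚ
aggregate I s = ratio (sum (map (λ b → occ b I) s)) (length I)

runsFrom : ℕ → List ℕ → List (List ℕ)
runsFrom prev [] = [] ∷ []
runsFrom prev (a ∷ as) = map (prev ∷_) (runsFrom prev as) ++ map (a ∷_) (runsFrom a as)

-- all valid buffer sequences on I (s_1 = a_1, s_t ∈ {s_{t-1}, a_t})
validRuns : List ℕ → List (List ℕ)
validRuns [] = [] ∷ []
validRuns (a ∷ as) = map (a ∷_) (runsFrom a as)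

Opt : List ℕ → ℚ
Opt I = foldr _⊔_ 0ℚ (map (aggregate I) (validRuns I))

-- Maj: buffer b, counter c
majGo : ℕ → ℕ → List ℕ → List ℕ
majGo b c [] = []
majGo b zero (a ∷ as) = a ∷ majGo a 1 as
majGo b (suc c) (a ∷ as) with a ≟ b
... | yes _ = b ∷ majGo b (suc (suc c)) as
... | no  _ = b ∷ majGo b c as

majRun : List ℕ → List ℕ
majRun [] = []
majRun (a ∷ as) = a ∷ majGo a 1 as

-- An (online) algorithm is represented by the buffer sequence it produces.
Algorithm : Set
Algorithm = List ℕ → List ℕ

Maj : Algorithm
Maj = majRun

value : Algorithm → List ℕ → ℚ
value 𝒜 I = aggregate I (𝒜 I)

LittleO : (ℕ → ℚ) → (ℕ → ℚ) → Set
LittleO h f = ∀ (ε : ℚ) → 0ℚ < ε → ∃[ N ] ∀ n → N ℕ.≤ n → ∣ h n ∣ ≤ ε * ∣ f n ∣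

Competitive : Algorithm → (ℕ → ℚ) → Set
Competitive 𝒜 f = ∃[ h ] (LittleO h f ×
  (∀ (I : List ℕ) → Opt I ≤ (f (length I) + h (length I)) * value 𝒜 I))

-- lim_{n→∞} f(n)/g(n) ≤ 1, read as limsup ≤ 1 (g eventually positive here):
-- for every ε > 0, eventually f(n) ≤ (1 + ε) g(n)
LimRatioAtMostOne : (ℕ → ℚ) → (ℕ → ℚ) → Set
LimRatioAtMostOne f g = ∀ (ε : ℚ) → 0ℚ < ε → ∃[ N ] ∀ n → N ℕ.≤ n → f n ≤ (1ℚ + ε) * g n

HasCompetitiveFunction : Algorithm → (ℕ → ℚ) → Set
HasCompetitiveFunction 𝒜 f = Competitive 𝒜 f ×
  (∀ (g : ℕ → ℚ) → Competitive 𝒜 g → LimRatioAtMostOne f g)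

half : ℕ → ℚ
half n = (+ n) / 2

module Submission where

-- Maj only buffers items of the input, so its score (n times its aggregate
-- frequency) is at least n; and if some b is a strict majority, the Boyer–Moore invariant
-- forces Maj to buffer b at some step, so the score is at least n - 1 + occ b. Either way
-- 2n·occ b ≤ (n+1)·score(Maj), and summing over the n steps of any run s gives
-- Opt ≤ (n/2 + 1/2)·Maj, i.e. Maj is n/2-competitive with h = 1/2.
--
-- On 1,0,2,0,3,0,… Maj buffers every fresh item twice and has value 1,
-- while keeping 0 from step 2 on has value ≥ n/2 - 1. So any g for which Maj is
-- g-competitive satisfies n/2 - 1 ≤ g(n) + h(n) with h ∈ o(g), which forces
-- n/2 ≤ (1+ε)·g(n) for large n.

open import Defs
open import Data.List using (List; []; _∷_; map; length; foldr; replicate)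
open import Data.List.Properties using (map-replicate)
open import Data.Nat.ListAction using (sum)
open import Data.List.Relation.Unary.All as All using (All; []; _∷_)
import Data.List.Relation.Unary.All.Properties as Allₚ
open import Data.List.Relation.Unary.Any using (here; there)
open import Data.List.Membership.Propositional using (_∈_)
open import Data.List.Membership.Propositional.Properties using (∈-map⁺; ∈-++⁺ʳ; ∈-++⁺ˡ)
open import Data.List.Relation.Binary.Subset.Propositional using (_⊆_)
open import Data.List.Relation.Binary.Subset.Propositional.Properties
  using (⊆-trans; xs⊆x∷xs; ∷⁺ʳ; ∈-∷⁺ʳ)
open import Data.Product using (_,_; proj₁; proj₂; ∃-syntax)
open import Function using (_∘_)
open import Relation.Nullary using (yes; no; contradiction)
open import Relation.Binary.PropositionalEquality

-- The combinatorics lives in ℕ; the module keeps its lemma names apart from those of ℚ.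
module Counting where

  open import Data.Nat using (ℕ; zero; suc; _+_; _*_; _≤_; _<_; _≟_; _≤?_; z≤n; s≤s)
  open import Data.Nat.Properties
  open import Data.Nat.Tactic.RingSolver using (solve-∀)
  open import Algebra.Properties.CommutativeSemigroup *-commutativeSemigroup using (x∙yz≈y∙xz)

  occ-∷-≢ : ∀ {m a} as → m ≢ a → occ m (a ∷ as) ≡ occ m as
  occ-∷-≢ {m} {a} as m≢a with m ≟ a
  ... | yes m≡a = contradiction m≡a m≢a
  ... | no _ = refl

  occ-∷-≤ : ∀ m a as → occ m (a ∷ as) ≤ suc (occ m as)
  occ-∷-≤ m a as with m ≟ a
  ... | yes _ = ≤-refl
  ... | no _ = n≤1+n (occ m as)

  occ≤length : ∀ m xs → occ m xs ≤ length xs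
  occ≤length m [] = z≤n
  occ≤length m (a ∷ as) = ≤-trans (occ-∷-≤ m a as) (s≤s (occ≤length m as))

  ∈⇒0<occ : ∀ {x xs} → x ∈ xs → 0 < occ x xs
  ∈⇒0<occ {x} {a ∷ as} x∈ with x ≟ a | x∈
  ... | yes _ | _ = s≤s z≤n
  ... | no x≢a | here x≡a = contradiction x≡a x≢a
  ... | no _ | there x∈as = ∈⇒0<occ x∈as

  majGo-length : ∀ b c xs → length (majGo b c xs) ≡ length xs
  majGo-length b c [] = refl
  majGo-length b zero (a ∷ as) = cong suc (majGo-length a 1 as)
  majGo-length b (suc c) (a ∷ as) with a ≟ b
  ... | yes _ = cong suc (majGo-length b (suc (suc c)) as)
  ... | no _ = cong suc (majGo-length b c as)

  majRun-length : ∀ I → length (majRun I) ≡ length I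
  majRun-length [] = refl
  majRun-length (a ∷ as) = cong suc (majGo-length a 1 as)

  majGo-⊆ : ∀ b c xs → majGo b c xs ⊆ b ∷ xs
  majGo-⊆ b c [] ()
  majGo-⊆ b zero (a ∷ as) = ∈-∷⁺ʳ (there (here refl)) (there ∘ majGo-⊆ a 1 as)
  majGo-⊆ b (suc c) (a ∷ as) with a ≟ b
  ... | yes _ = ⊆-trans (∈-∷⁺ʳ (here refl) (majGo-⊆ b (2 + c) as)) (∷⁺ʳ b (xs⊆x∷xs as a))
  ... | no _ = ⊆-trans (∈-∷⁺ʳ (here refl) (majGo-⊆ b c as)) (∷⁺ʳ b (xs⊆x∷xs as a))

  majRun-⊆ : ∀ I → majRun I ⊆ I
  majRun-⊆ [] ()
  majRun-⊆ (a ∷ as) = ∈-∷⁺ʳ (here refl) (majGo-⊆ a 1 as)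

  majGo-zero : ∀ b xs → majGo b 0 xs ≡ majRun xs
  majGo-zero b [] = refl
  majGo-zero b (a ∷ as) = refl

  -- While m is not buffered, each occurrence of m decrements the counter.
  majGo-majority : ∀ {m} b c xs → c + length xs < 2 * occ m xs → b ≢ m → m ∈ majGo b c xs
  majGo-majority b c [] ()
  majGo-majority {m} b zero (a ∷ as) maj b≢m with m ≟ a
  ... | yes refl = here refl
  ... | no m≢a = there (majGo-majority a 1 as maj (m≢a ∘ sym))
  majGo-majority {m} b (suc c) (a ∷ as) maj b≢m with a ≟ b
  ... | yes refl = there (majGo-majority a (2 + c) as maj′ b≢m)
    where
    maj′ : 2 + c + length as < 2 * occ m as
    maj′ = subst₂ _<_ (+-suc (suc c) (length as)) (cong (2 *_) (occ-∷-≢ as (b≢m ∘ sym))) maj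
  ... | no _ = there (majGo-majority b c as maj′ b≢m)
    where
    maj′ : c + length as < 2 * occ m as
    maj′ = +-cancelˡ-< 2 _ _ (begin-strict
      2 + (c + length as)  ≡⟨ +-suc (suc c) (length as) ⟨
      suc c + suc (length as) <⟨ maj ⟩
      2 * occ m (a ∷ as)   ≤⟨ *-monoʳ-≤ 2 (occ-∷-≤ m a as) ⟩
      2 * suc (occ m as)   ≡⟨ *-suc 2 (occ m as) ⟩
      2 + 2 * occ m as     ∎)
      where open ≤-Reasoning

  majRun-majority : ∀ {m} I → length I < 2 * occ m I → m ∈ majRun I
  majRun-majority [] ()
  majRun-majority {m} (a ∷ as) maj with m ≟ a
  ... | yes refl = here refl
  ... | no m≢a = there (majGo-majority a 1 as maj (m≢a ∘ sym))

  module _ {A : Set} (f : A → ℕ) where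

    length≤sum : ∀ xs → (∀ {x} → x ∈ xs → 0 < f x) → length xs ≤ sum (map f xs)
    length≤sum [] _ = z≤n
    length≤sum (x ∷ xs) pos = +-mono-≤ (pos (here refl)) (length≤sum xs (pos ∘ there))

    sum≤length : ∀ xs → (∀ {x} → x ∈ xs → f x ≤ 1) → sum (map f xs) ≤ length xs
    sum≤length [] _ = z≤n
    sum≤length (x ∷ xs) ≤1 = +-mono-≤ (≤1 (here refl)) (sum≤length xs (≤1 ∘ there))

    length+≤sum : ∀ {y} xs → (∀ {x} → x ∈ xs → 0 < f x) → y ∈ xs → length xs + f y ≤ suc (sum (map f xs))
    length+≤sum (x ∷ xs) pos (here refl) =
      s≤s (subst (_≤ f x + sum (map f xs)) (+-comm (f x) (length xs))
                 (+-monoʳ-≤ (f x) (length≤sum xs (pos ∘ there))))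
    length+≤sum (x ∷ xs) pos (there y∈) =
      s≤s (≤-trans (length+≤sum xs (pos ∘ there) y∈) (+-monoˡ-≤ (sum (map f xs)) (pos (here refl))))

    *-sum≤length* : ∀ d C xs → (∀ x → d * f x ≤ C) → d * sum (map f xs) ≤ length xs * C
    *-sum≤length* d C [] _ = ≤-reflexive (*-zeroʳ d)
    *-sum≤length* d C (x ∷ xs) bound = begin
      d * (f x + sum (map f xs))        ≡⟨ *-distribˡ-+ d (f x) _ ⟩
      d * f x + d * sum (map f xs)      ≤⟨ +-mono-≤ (bound x) (*-sum≤length* d C xs bound) ⟩
      C + length xs * C                 ∎
      where open ≤-Reasoning

  sum-replicate : ∀ n x → sum (replicate n x) ≡ n * x
  sum-replicate zero x = refl
  sum-replicate (suc n) x = cong (x +_) (sum-replicate n x)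

  -- aggregate I s is definitionally ratio (score I s) (length I).
  score : List ℕ → List ℕ → ℕ
  score I s = sum (map (λ b → occ b I) s)

  length≤score-majRun : ∀ I → length I ≤ score I (majRun I)
  length≤score-majRun I = subst (_≤ score I (majRun I)) (majRun-length I)
    (length≤sum (λ b → occ b I) (majRun I) (∈⇒0<occ ∘ majRun-⊆ I))

  minority-bound : ∀ {n k M} → 2 * k ≤ n → n ≤ M → 2 * n * k ≤ suc n * M
  minority-bound {n} {k} {M} 2k≤n n≤M = begin
    2 * n * k    ≡⟨ cong (_* k) (*-comm 2 n) ⟩
    n * 2 * k    ≡⟨ *-assoc n 2 k ⟩
    n * (2 * k)  ≤⟨ *-monoʳ-≤ n (≤-trans 2k≤n n≤M) ⟩
    n * M        ≤⟨ m≤n+m (n * M) M ⟩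
    suc n * M    ∎
    where open ≤-Reasoning

  majority-bound : ∀ {n k M} → n < 2 * k → k ≤ n → n + k ≤ suc M → 2 * n * k ≤ suc n * M
  majority-bound {n} {zero} ()
  majority-bound {n} {k@(suc _)} {M} _ k≤n n+k≤1+M = +-cancelʳ-≤ (suc n) _ _ (begin
    2 * n * k + suc n                ≡⟨ expand n k ⟩
    n * k + (n * k + 1) + n          ≤⟨ +-monoˡ-≤ n (+-monoʳ-≤ (n * k) (+-mono-≤ (*-monoʳ-≤ n k≤n) (s≤s z≤n))) ⟩
    n * k + (n * n + k) + n          ≡⟨ regroup n k ⟩
    suc n * (n + k)                  ≤⟨ *-monoʳ-≤ (suc n) n+k≤1+M ⟩
    suc n * suc M                    ≡⟨ *-suc (suc n) M ⟩
    suc n + suc n * M                ≡⟨ +-comm (suc n) (suc n * M) ⟩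
    suc n * M + suc n                ∎)
    where
    open ≤-Reasoning
    expand : ∀ n k → 2 * n * k + suc n ≡ n * k + (n * k + 1) + n
    expand = solve-∀
    regroup : ∀ n k → n * k + (n * n + k) + n ≡ suc n * (n + k)
    regroup = solve-∀

  occ-bound : ∀ I b → 2 * length I * occ b I ≤ suc (length I) * score I (majRun I)
  occ-bound I b with 2 * occ b I ≤? length I
  ... | yes minority = minority-bound minority (length≤score-majRun I)
  ... | no ¬minority = majority-bound majority (occ≤length b I) (begin
    length I + occ b I  ≡⟨ cong (_+ occ b I) (majRun-length I) ⟨
    length (majRun I) + occ b I
      ≤⟨ length+≤sum (λ x → occ x I) (majRun I) (∈⇒0<occ ∘ majRun-⊆ I) (majRun-majority I majority) ⟩
    suc (score I (majRun I)) ∎)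
    where
    open ≤-Reasoning
    majority : length I < 2 * occ b I
    majority = ≰⇒> ¬minority

  score-bound : ∀ I s → length s ≡ length I → 2 * score I s ≤ suc (length I) * score I (majRun I)
  score-bound [] [] refl = z≤n
  score-bound I@(_ ∷ _) s s≡I = *-cancelˡ-≤ (length I) (begin
    length I * (2 * score I s)  ≡⟨ *-assoc (length I) 2 (score I s) ⟨
    length I * 2 * score I s    ≡⟨ cong (_* score I s) (*-comm (length I) 2) ⟩
    2 * length I * score I s    ≤⟨ *-sum≤length* (λ b → occ b I) (2 * length I) C s (occ-bound I) ⟩
    length s * C                ≡⟨ cong (_* C) s≡I ⟩
    length I * C                ∎)
    where
    open ≤-Reasoning
    C : ℕ
    C = suc (length I) * score I (majRun I)

  runsFrom-length : ∀ p xs → All (λ s → length s ≡ length xs) (runsFrom p xs)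
  runsFrom-length p [] = refl ∷ []
  runsFrom-length p (a ∷ as) = Allₚ.++⁺ (Allₚ.map⁺ (All.map (cong suc) (runsFrom-length p as)))
                                        (Allₚ.map⁺ (All.map (cong suc) (runsFrom-length a as)))

  validRuns-length : ∀ I → All (λ s → length s ≡ length I) (validRuns I)
  validRuns-length [] = refl ∷ []
  validRuns-length (a ∷ as) = Allₚ.map⁺ (All.map (cong suc) (runsFrom-length a as))

  runsFrom-constant : ∀ p xs → replicate (length xs) p ∈ runsFrom p xs
  runsFrom-constant p [] = here refl
  runsFrom-constant p (a ∷ as) = ∈-++⁺ˡ (∈-map⁺ (p ∷_) (runsFrom-constant p as))

  zigzag : ℕ → ℕ → List ℕ
  zigzag j zero = []
  zigzag j (suc zero) = suc j ∷ []
  zigzag j (suc (suc n)) = suc j ∷ 0 ∷ zigzag (suc j) n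

  zigzag-length : ∀ j n → length (zigzag j n) ≡ n
  zigzag-length j zero = refl
  zigzag-length j (suc zero) = refl
  zigzag-length j (suc (suc n)) = cong (suc ∘ suc) (zigzag-length (suc j) n)

  zigzag-zeros : ∀ j n → suc n ≤ 2 * occ 0 (zigzag j (2 + n))
  zigzag-zeros j zero = s≤s z≤n
  zigzag-zeros j (suc zero) = s≤s (s≤s z≤n)
  zigzag-zeros j (suc (suc n)) =
    subst (3 + n ≤_) (sym (*-suc 2 (occ 0 (zigzag (suc j) (2 + n))))) (s≤s (s≤s (zigzag-zeros (suc j) n)))

  zigzag-fresh : ∀ {j k} n → k < j → occ (suc k) (zigzag j n) ≡ 0
  zigzag-fresh zero _ = refl
  zigzag-fresh (suc zero) k<j = occ-∷-≢ [] (<⇒≢ (s≤s k<j))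
  zigzag-fresh (suc (suc n)) k<j =
    trans (occ-∷-≢ _ (<⇒≢ (s≤s k<j))) (zigzag-fresh n (m<n⇒m<1+n k<j))

  zigzag-occ≤1 : ∀ j n {x} → 0 < x → occ x (zigzag j n) ≤ 1
  zigzag-occ≤1 j zero _ = z≤n
  zigzag-occ≤1 j (suc zero) {suc k} _ with suc k ≟ suc j
  ... | yes _ = ≤-refl
  ... | no _ = z≤n
  zigzag-occ≤1 j (suc (suc n)) {suc k} _ with suc k ≟ suc j
  ... | yes refl = s≤s (≤-reflexive (zigzag-fresh n ≤-refl))
  ... | no _ = zigzag-occ≤1 (suc j) n (s≤s z≤n)

  majRun-zigzag-positive : ∀ j n {x} → x ∈ majRun (zigzag j n) → 0 < x
  majRun-zigzag-positive j (suc zero) (here refl) = s≤s z≤n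
  majRun-zigzag-positive j (suc (suc n)) (here refl) = s≤s z≤n
  majRun-zigzag-positive j (suc (suc n)) (there (here refl)) = s≤s z≤n
  majRun-zigzag-positive j (suc (suc n)) {x} (there (there x∈)) =
    majRun-zigzag-positive (suc j) n (subst (x ∈_) (majGo-zero (suc j) (zigzag (suc j) n)) x∈)

  score-majRun-zigzag : ∀ n → score (zigzag 0 n) (majRun (zigzag 0 n)) ≡ n
  score-majRun-zigzag n = trans (≤-antisym
    (subst (score I (majRun I) ≤_) (majRun-length I)
      (sum≤length (λ b → occ b I) (majRun I) (zigzag-occ≤1 0 n ∘ majRun-zigzag-positive 0 n)))
    (length≤score-majRun I)) (zigzag-length 0 n)
    where
    I : List ℕ
    I = zigzag 0 n

  score-zigzag-witness : ∀ n → n * (2 + n) ≤ 2 * score (zigzag 0 (2 + n)) (1 ∷ replicate (suc n) 0)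
  score-zigzag-witness n = begin
    n * (2 + n)          ≡⟨ *-suc n (suc n) ⟩
    n + n * suc n        ≤⟨ +-monoˡ-≤ (n * suc n) (n≤1+n n) ⟩
    suc n * suc n        ≤⟨ *-monoʳ-≤ (suc n) (zigzag-zeros 0 n) ⟩
    suc n * (2 * zeros)  ≡⟨ x∙yz≈y∙xz (suc n) 2 zeros ⟩
    2 * (suc n * zeros)  ≡⟨ cong (2 *_) sum-zeros ⟨
    2 * sum (map (λ b → occ b I) (replicate (suc n) 0))  ≤⟨ *-monoʳ-≤ 2 (m≤n+m _ (occ 1 I)) ⟩
    2 * score I (1 ∷ replicate (suc n) 0) ∎
    where
    open ≤-Reasoning
    I : List ℕ
    I = zigzag 0 (2 + n)
    zeros : ℕ
    zeros = occ 0 I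
    sum-zeros : sum (map (λ b → occ b I) (replicate (suc n) 0)) ≡ suc n * zeros
    sum-zeros = trans (cong sum (map-replicate (λ b → occ b I) (suc n) 0)) (sum-replicate (suc n) zeros)

  zigzag-run : ∀ n → 1 ∷ replicate (suc n) 0 ∈ validRuns (zigzag 0 (2 + n))
  zigzag-run n = ∈-map⁺ (1 ∷_) (∈-++⁺ʳ (map (1 ∷_) (runsFrom 1 R)) (∈-map⁺ (0 ∷_)
    (subst (λ k → replicate k 0 ∈ runsFrom 0 R) (zigzag-length 1 n) (runsFrom-constant 0 R))))
    where
    R : List ℕ
    R = zigzag 1 n

open Counting

open import Data.Nat as ℕ using (ℕ; zero; suc; z≤n; s≤s)
import Data.Nat.Properties as ℕₚ
open import Data.Integer as ℤ using (+_)
import Data.Integer.Properties as ℤₚ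
open import Data.Rational
  using ( ℚ; mkℚ; _/_; 0ℚ; 1ℚ; ½; _≤_; _<_; _+_; _*_; -_; ∣_∣; _⊔_; _⊓_; toℚᵘ; *≤*; *<*
        ; Positive; NonNegative; positive; nonNegative)
open import Data.Rational.Properties
import Data.Rational.Unnormalised as ℚᵘ
import Data.Rational.Unnormalised.Properties as ℚᵘₚ
open import Data.Rational.Solver using (module +-*-Solver)
open +-*-Solver using (solve; _:+_; _:*_; :-_; _:=_; con)
open import Data.Sum using (inj₁; inj₂; [_,_]′)

ι : ℕ → ℚ
ι k = + k / 1

toℚᵘ-/ : ∀ i m → toℚᵘ (i / suc m) ℚᵘ.≃ ℚᵘ.mkℚᵘ i m
toℚᵘ-/ i m = toℚᵘ-fromℚᵘ (ℚᵘ.mkℚᵘ i m)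

ι-+ : ∀ a b → ι (a ℕ.+ b) ≡ ι a + ι b
ι-+ a b = toℚᵘ-injective (begin
  toℚᵘ (ι (a ℕ.+ b))                          ≈⟨ toℚᵘ-/ (+ (a ℕ.+ b)) 0 ⟩
  ℚᵘ.mkℚᵘ (+ (a ℕ.+ b)) 0                     ≈⟨ ℚᵘ.*≡* (cong (ℤ._* + 1) numerators) ⟩
  ℚᵘ.mkℚᵘ (+ a) 0 ℚᵘ.+ ℚᵘ.mkℚᵘ (+ b) 0        ≈⟨ ℚᵘₚ.+-cong (toℚᵘ-/ (+ a) 0) (toℚᵘ-/ (+ b) 0) ⟨
  toℚᵘ (ι a) ℚᵘ.+ toℚᵘ (ι b)                  ≈⟨ toℚᵘ-homo-+ (ι a) (ι b) ⟨
  toℚᵘ (ι a + ι b)                            ∎)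
  where
  open ℚᵘₚ.≃-Reasoning
  numerators : + (a ℕ.+ b) ≡ + a ℤ.* + 1 ℤ.+ + b ℤ.* + 1
  numerators = trans (ℤₚ.pos-+ a b) (sym (cong₂ ℤ._+_ (ℤₚ.*-identityʳ (+ a)) (ℤₚ.*-identityʳ (+ b))))

ι-* : ∀ a b → ι (a ℕ.* b) ≡ ι a * ι b
ι-* a b = toℚᵘ-injective (begin
  toℚᵘ (ι (a ℕ.* b))                          ≈⟨ toℚᵘ-/ (+ (a ℕ.* b)) 0 ⟩
  ℚᵘ.mkℚᵘ (+ (a ℕ.* b)) 0                     ≈⟨ ℚᵘ.*≡* (cong (ℤ._* + 1) (ℤₚ.pos-* a b)) ⟩
  ℚᵘ.mkℚᵘ (+ a) 0 ℚᵘ.* ℚᵘ.mkℚᵘ (+ b) 0        ≈⟨ ℚᵘₚ.*-cong (toℚᵘ-/ (+ a) 0) (toℚᵘ-/ (+ b) 0) ⟨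
  toℚᵘ (ι a) ℚᵘ.* toℚᵘ (ι b)                  ≈⟨ toℚᵘ-homo-* (ι a) (ι b) ⟨
  toℚᵘ (ι a * ι b)                            ∎)
  where open ℚᵘₚ.≃-Reasoning

ι-mono-≤ : ∀ {a b} → a ℕ.≤ b → ι a ≤ ι b
ι-mono-≤ {a} {b} a≤b = toℚᵘ-cancel-≤ (begin
  toℚᵘ (ι a)       ≃⟨ toℚᵘ-/ (+ a) 0 ⟩
  ℚᵘ.mkℚᵘ (+ a) 0  ≤⟨ ℚᵘ.*≤* (ℤₚ.*-monoʳ-≤-nonNeg (+ 1) (ℤ.+≤+ a≤b)) ⟩
  ℚᵘ.mkℚᵘ (+ b) 0  ≃⟨ toℚᵘ-/ (+ b) 0 ⟨
  toℚᵘ (ι b)       ∎)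
  where open ℚᵘₚ.≤-Reasoning

ι-pos : ∀ k → Positive (ι (suc k))
ι-pos k = normalize-pos (suc k) 1

ratio-*-ι : ∀ a m → ratio a (suc m) * ι (suc m) ≡ ι a
ratio-*-ι a m = toℚᵘ-injective (begin
  toℚᵘ (ratio a (suc m) * ι (suc m))            ≈⟨ toℚᵘ-homo-* (ratio a (suc m)) (ι (suc m)) ⟩
  toℚᵘ (ratio a (suc m)) ℚᵘ.* toℚᵘ (ι (suc m))  ≈⟨ ℚᵘₚ.*-cong (toℚᵘ-/ (+ a) m) (toℚᵘ-/ (+ suc m) 0) ⟩
  ℚᵘ.mkℚᵘ (+ a) m ℚᵘ.* ℚᵘ.mkℚᵘ (+ suc m) 0     ≈⟨ ℚᵘ.*≡* cross ⟩
  ℚᵘ.mkℚᵘ (+ a) 0                               ≈⟨ toℚᵘ-/ (+ a) 0 ⟨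
  toℚᵘ (ι a)                                    ∎)
  where
  open ℚᵘₚ.≃-Reasoning
  cross : (+ a ℤ.* + suc m) ℤ.* + 1 ≡ + a ℤ.* + (suc m ℕ.* 1)
  cross = trans (ℤₚ.*-identityʳ _) (cong (λ k → + a ℤ.* + k) (sym (ℕₚ.*-identityʳ (suc m))))

ratio-self : ∀ m → ratio (suc m) (suc m) ≡ 1ℚ
ratio-self m = toℚᵘ-injective (ℚᵘₚ.≃-trans (toℚᵘ-/ (+ suc m) m) (ℚᵘ.*≡* (ℤₚ.*-comm (+ suc m) (+ 1))))

half≡ι*½ : ∀ n → half n ≡ ι n * ½
half≡ι*½ n = begin
  half n            ≡⟨ solve 1 (λ x → x := x :* con (ι 2) :* con ½) refl (half n) ⟩
  half n * ι 2 * ½  ≡⟨ cong (_* ½) (ratio-*-ι n 1) ⟩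
  ι n * ½           ∎
  where open ≡-Reasoning

half-+ : ∀ m n → half (m ℕ.+ n) ≡ half m + half n
half-+ m n = begin
  half (m ℕ.+ n)       ≡⟨ half≡ι*½ (m ℕ.+ n) ⟩
  ι (m ℕ.+ n) * ½      ≡⟨ cong (_* ½) (ι-+ m n) ⟩
  (ι m + ι n) * ½      ≡⟨ *-distribʳ-+ ½ (ι m) (ι n) ⟩
  ι m * ½ + ι n * ½    ≡⟨ cong₂ _+_ (half≡ι*½ m) (half≡ι*½ n) ⟨
  half m + half n      ∎
  where open ≡-Reasoning

half-nonNeg : ∀ n → 0ℚ ≤ half n
half-nonNeg n = nonNegative⁻¹ (half n) {{normalize-nonNeg n 2}}

ι2*half*ι : ∀ b c → ι 2 * (half b * ι c) ≡ ι (b ℕ.* c)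
ι2*half*ι b c = begin
  ι 2 * (half b * ι c)      ≡⟨ cong (λ h → ι 2 * (h * ι c)) (half≡ι*½ b) ⟩
  ι 2 * (ι b * ½ * ι c)     ≡⟨ solve 2 (λ x y → con (ι 2) :* (x :* con ½ :* y) := x :* y) refl (ι b) (ι c) ⟩
  ι b * ι c                 ≡⟨ ι-* b c ⟨
  ι (b ℕ.* c)               ∎
  where open ≡-Reasoning

ι≤half*ι : ∀ {a b c} → 2 ℕ.* a ℕ.≤ b ℕ.* c → ι a ≤ half b * ι c
ι≤half*ι {a} {b} {c} 2a≤bc = *-cancelˡ-≤-pos (ι 2) {{ι-pos 1}} (begin
  ι 2 * ι a              ≡⟨ ι-* 2 a ⟨
  ι (2 ℕ.* a)            ≤⟨ ι-mono-≤ 2a≤bc ⟩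
  ι (b ℕ.* c)            ≡⟨ ι2*half*ι b c ⟨
  ι 2 * (half b * ι c)   ∎)
  where open ≤-Reasoning

half*ι≤ι : ∀ {a b c} → b ℕ.* c ℕ.≤ 2 ℕ.* a → half b * ι c ≤ ι a
half*ι≤ι {a} {b} {c} bc≤2a = *-cancelˡ-≤-pos (ι 2) {{ι-pos 1}} (begin
  ι 2 * (half b * ι c)   ≡⟨ ι2*half*ι b c ⟩
  ι (b ℕ.* c)            ≤⟨ ι-mono-≤ bc≤2a ⟩
  ι (2 ℕ.* a)            ≡⟨ ι-* 2 a ⟩
  ι 2 * ι a              ∎)
  where open ≤-Reasoning

ratio≤*ratio : ∀ {a b} m q → ι a ≤ q * ι b → ratio a (suc m) ≤ q * ratio b (suc m)
ratio≤*ratio {a} {b} m q a≤qb = *-cancelʳ-≤-pos (ι (suc m)) {{ι-pos m}} (begin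
  ratio a (suc m) * ι (suc m)          ≡⟨ ratio-*-ι a m ⟩
  ι a                                  ≤⟨ a≤qb ⟩
  q * ι b                              ≡⟨ cong (q *_) (ratio-*-ι b m) ⟨
  q * (ratio b (suc m) * ι (suc m))    ≡⟨ *-assoc q _ _ ⟨
  q * ratio b (suc m) * ι (suc m)      ∎)
  where open ≤-Reasoning

≤-ratio : ∀ {a} m q → q * ι (suc m) ≤ ι a → q ≤ ratio a (suc m)
≤-ratio {a} m q qm≤a = *-cancelʳ-≤-pos (ι (suc m)) {{ι-pos m}}
  (≤-trans qm≤a (≤-reflexive (sym (ratio-*-ι a m))))

archimedean : ∀ {ε} → 0ℚ < ε → ∀ k → ∃[ N ] ∀ n → N ℕ.≤ n → ι k ≤ ε * ι n
archimedean {mkℚ (+ zero) _ _} (*<* (ℤ.+<+ ()))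
archimedean {mkℚ (+ suc p) d _} 0<ε k = k ℕ.* suc d , λ n N≤n → begin
  ι k                      ≡⟨ *-identityʳ (ι k) ⟨
  ι k * 1ℚ                 ≤⟨ *-monoˡ-≤-nonNeg (ι k) {{normalize-nonNeg k 1}} (ι-mono-≤ {1} {suc p} (s≤s z≤n)) ⟩
  ι k * ι (suc p)          ≡⟨ cong (ι k *_) ε*ι[d]≡ι[p] ⟨
  ι k * (ε * ι (suc d))    ≡⟨ solve 3 (λ x e y → x :* (e :* y) := e :* (x :* y)) refl (ι k) ε (ι (suc d)) ⟩
  ε * (ι k * ι (suc d))    ≡⟨ cong (ε *_) (ι-* k (suc d)) ⟨
  ε * ι (k ℕ.* suc d)      ≤⟨ *-monoˡ-≤-nonNeg ε (ι-mono-≤ N≤n) ⟩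
  ε * ι n                  ∎
  where
  open ≤-Reasoning
  ε = mkℚ (+ suc p) d _
  ε*ι[d]≡ι[p] : ε * ι (suc d) ≡ ι (suc p)
  ε*ι[d]≡ι[p] = trans (cong (_* ι (suc d)) (sym (↥p/↧p≡p ε))) (ratio-*-ι (suc p) d)

archimedean-half : ∀ {ε} → 0ℚ < ε → ∀ k → ∃[ N ] ∀ n → N ℕ.≤ n → ι k ≤ ε * half n
archimedean-half {ε} 0<ε k with archimedean 0<ε (2 ℕ.* k)
... | N , large = N , λ n N≤n → *-cancelˡ-≤-pos (ι 2) {{ι-pos 1}} (begin
  ι 2 * ι k             ≡⟨ ι-* 2 k ⟨
  ι (2 ℕ.* k)           ≤⟨ large n N≤n ⟩
  ε * ι n               ≡⟨ solve 2 (λ e x → e :* x := con (ι 2) :* (e :* (x :* con ½))) refl ε (ι n) ⟩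
  ι 2 * (ε * (ι n * ½)) ≡⟨ cong (λ h → ι 2 * (ε * h)) (half≡ι*½ n) ⟨
  ι 2 * (ε * half n)    ∎)
  where open ≤-Reasoning

foldr-⊔-lub : ∀ {q} xs → 0ℚ ≤ q → All (_≤ q) xs → foldr _⊔_ 0ℚ xs ≤ q
foldr-⊔-lub [] 0≤q [] = 0≤q
foldr-⊔-lub (x ∷ xs) 0≤q (x≤q ∷ xs≤q) = ⊔-lub x≤q (foldr-⊔-lub xs 0≤q xs≤q)

∈⇒≤foldr-⊔ : ∀ {x xs} → x ∈ xs → x ≤ foldr _⊔_ 0ℚ xs
∈⇒≤foldr-⊔ {xs = y ∷ ys} (here refl) = p≤p⊔q y _
∈⇒≤foldr-⊔ {xs = y ∷ ys} (there x∈) = ≤-trans (∈⇒≤foldr-⊔ x∈) (p≤q⊔p y _)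

Opt≤[half+½]*Maj : ∀ I → Opt I ≤ (half (length I) + ½) * value Maj I
Opt≤[half+½]*Maj [] = ≤-reflexive (sym (*-zeroʳ (half 0 + ½)))
Opt≤[half+½]*Maj I@(_ ∷ as) =
  foldr-⊔-lub _ 0≤bound (Allₚ.map⁺ (All.map (λ {s} → aggregate≤bound {s}) (validRuns-length I)))
  where
  n : ℕ
  n = length I
  bound : ℚ
  bound = (half n + ½) * value Maj I
  0≤bound : 0ℚ ≤ bound
  0≤bound = nonNegative⁻¹ bound
    {{nonNeg*nonNeg⇒nonNeg (half n + ½) {{nonNeg+nonNeg⇒nonNeg (half n) {{normalize-nonNeg n 2}} ½}}
                           (value Maj I) {{normalize-nonNeg (score I (majRun I)) n}}}}
  aggregate≤bound : ∀ {s} → length s ≡ n → aggregate I s ≤ bound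
  aggregate≤bound {s} s≡I = subst (λ q → aggregate I s ≤ q * value Maj I)
    (trans (half-+ 1 n) (+-comm ½ (half n)))
    (ratio≤*ratio {score I s} {score I (majRun I)} (length as) (half (suc n))
      (ι≤half*ι {score I s} {suc n} {score I (majRun I)} (score-bound I s s≡I)))

½=o[half] : LittleO (λ _ → ½) half
½=o[half] ε 0<ε = let N , large = archimedean-half 0<ε 1 in N , λ n N≤n → begin
  ½                ≤⟨ *≤* (ℤ.+≤+ (s≤s z≤n)) ⟩
  1ℚ               ≤⟨ large n N≤n ⟩
  ε * half n       ≡⟨ cong (ε *_) (0≤p⇒∣p∣≡p (half-nonNeg n)) ⟨
  ε * ∣ half n ∣   ∎
  where open ≤-Reasoning

Maj-competitive : Competitive Maj half
Maj-competitive = (λ _ → ½) , ½=o[half] , Opt≤[half+½]*Maj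

half≤Opt-zigzag : ∀ n → half n ≤ Opt (zigzag 0 (2 ℕ.+ n))
half≤Opt-zigzag n = ≤-trans
  (≤-ratio {score I w} (suc (length (zigzag 1 n))) (half n) (half*ι≤ι {score I w} {n} {length I} witness))
  (∈⇒≤foldr-⊔ (∈-map⁺ (aggregate I) (zigzag-run n)))
  where
  I w : List ℕ
  I = zigzag 0 (2 ℕ.+ n)
  w = 1 ∷ replicate (suc n) 0
  witness : n ℕ.* length I ℕ.≤ 2 ℕ.* score I w
  witness = subst (λ k → n ℕ.* k ℕ.≤ 2 ℕ.* score I w) (sym (zigzag-length 0 (2 ℕ.+ n))) (score-zigzag-witness n)

value-Maj-zigzag : ∀ n → value Maj (zigzag 0 (suc n)) ≡ 1ℚ
value-Maj-zigzag n = trans (cong₂ ratio (score-majRun-zigzag (suc n)) (zigzag-length 0 (suc n))) (ratio-self n)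

half≤g+h : ∀ {g h : ℕ → ℚ} → (∀ I → Opt I ≤ (g (length I) + h (length I)) * value Maj I) →
           ∀ n → half n ≤ g (2 ℕ.+ n) + h (2 ℕ.+ n)
half≤g+h {g} {h} bound n = begin
  half n                                         ≤⟨ half≤Opt-zigzag n ⟩
  Opt I                                          ≤⟨ bound I ⟩
  (g (length I) + h (length I)) * value Maj I
    ≡⟨ cong₂ (λ k v → (g k + h k) * v) (zigzag-length 0 (2 ℕ.+ n)) (value-Maj-zigzag (suc n)) ⟩
  (g (2 ℕ.+ n) + h (2 ℕ.+ n)) * 1ℚ               ≡⟨ *-identityʳ _ ⟩
  g (2 ℕ.+ n) + h (2 ℕ.+ n)                      ∎
  where
  open ≤-Reasoning
  I : List ℕ
  I = zigzag 0 (2 ℕ.+ n)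

p≤∣p∣ : ∀ p → p ≤ ∣ p ∣
p≤∣p∣ p with ≤-total 0ℚ p
... | inj₁ 0≤p = ≤-reflexive (sym (0≤p⇒∣p∣≡p 0≤p))
... | inj₂ p≤0 = ≤-trans p≤0 (0≤∣p∣ p)

0<⊓ : ∀ {p q} → 0ℚ < p → 0ℚ < q → 0ℚ < p ⊓ q
0<⊓ {p} {q} 0<p 0<q with ⊓-sel p q
... | inj₁ p⊓q≡p = subst (0ℚ <_) (sym p⊓q≡p) 0<p
... | inj₂ p⊓q≡q = subst (0ℚ <_) (sym p⊓q≡q) 0<q

small-perturbation-nonPos : ∀ {A B δ} → A ≤ 0ℚ → δ ≤ 1ℚ → ∣ B ∣ ≤ δ * ∣ A ∣ → A + B ≤ 0ℚ
small-perturbation-nonPos {A} {B} {δ} A≤0 δ≤1 ∣B∣≤δ∣A∣ = begin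
  A + B               ≤⟨ +-monoʳ-≤ A (≤-trans (p≤∣p∣ B) ∣B∣≤δ∣A∣) ⟩
  A + δ * ∣ A ∣       ≤⟨ +-monoʳ-≤ A (*-monoʳ-≤-nonNeg ∣ A ∣ {{∣-∣-nonNeg A}} δ≤1) ⟩
  A + 1ℚ * ∣ A ∣      ≡⟨ cong (λ a → A + 1ℚ * a) ∣A∣≡-A ⟩
  A + 1ℚ * - A        ≡⟨ solve 1 (λ a → a :+ con 1ℚ :* (:- a) := con 0ℚ) refl A ⟩
  0ℚ                  ∎
  where
  open ≤-Reasoning
  ∣A∣≡-A : ∣ A ∣ ≡ - A
  ∣A∣≡-A = trans (sym (∣-p∣≡∣p∣ A)) (0≤p⇒∣p∣≡p (neg-antimono-≤ A≤0))

small-perturbation-nonNeg : ∀ {A B δ} → 0ℚ ≤ A → ∣ B ∣ ≤ δ * ∣ A ∣ → A + B ≤ A + δ * A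
small-perturbation-nonNeg {A} {B} {δ} 0≤A ∣B∣≤δ∣A∣ =
  +-monoʳ-≤ A (≤-trans (p≤∣p∣ B) (subst (λ a → ∣ B ∣ ≤ δ * a) (0≤p⇒∣p∣≡p 0≤A) ∣B∣≤δ∣A∣))

-- Applied with L = n/2 - 1, A = g n, B = h n; the case A ≤ 0 is impossible since L > 0.
absorb-perturbation : ∀ {L A B δ ε} → 0ℚ < ε → δ ≤ 1ℚ → δ ≤ ½ * ε → ι 4 ≤ ε * L →
                      L ≤ A + B → ∣ B ∣ ≤ δ * ∣ A ∣ → 1ℚ + L ≤ (1ℚ + ε) * A
absorb-perturbation {L} {A} {B} {δ} {ε} 0<ε δ≤1 δ≤½ε 4≤εL L≤A+B ∣B∣≤δ∣A∣ =
  [ nonNegative-case , nonPositive-case ]′ (≤-total 0ℚ A)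
  where
  open ≤-Reasoning
  instance
    ε-nonNeg : NonNegative ε
    ε-nonNeg = nonNegative (<⇒≤ 0<ε)

  nonPositive-case : A ≤ 0ℚ → 1ℚ + L ≤ (1ℚ + ε) * A
  nonPositive-case A≤0 = contradiction (<-≤-trans (*<* (ℤ.+<+ (s≤s z≤n))) 4≤0) (<-irrefl refl)
    where
    4≤0 : ι 4 ≤ 0ℚ
    4≤0 = begin
      ι 4          ≤⟨ 4≤εL ⟩
      ε * L        ≤⟨ *-monoˡ-≤-nonNeg ε (≤-trans L≤A+B (small-perturbation-nonPos {δ = δ} A≤0 δ≤1 ∣B∣≤δ∣A∣)) ⟩
      ε * 0ℚ       ≡⟨ *-zeroʳ ε ⟩
      0ℚ           ∎

  nonNegative-case : 0ℚ ≤ A → 1ℚ + L ≤ (1ℚ + ε) * A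
  nonNegative-case 0≤A = begin
    1ℚ + L                            ≤⟨ +-monoʳ-≤ 1ℚ L≤A+δA ⟩
    1ℚ + (A + δ * A)                  ≤⟨ +-mono-≤ 1≤½εA (+-monoʳ-≤ A δA≤½εA) ⟩
    ½ * (ε * A) + (A + ½ * (ε * A))
      ≡⟨ solve 2 (λ e a → con ½ :* (e :* a) :+ (a :+ con ½ :* (e :* a)) := (con 1ℚ :+ e) :* a) refl ε A ⟩
    (1ℚ + ε) * A                      ∎
    where
    instance
      A-nonNeg : NonNegative A
      A-nonNeg = nonNegative 0≤A
    L≤A+δA : L ≤ A + δ * A
    L≤A+δA = ≤-trans L≤A+B (small-perturbation-nonNeg {δ = δ} 0≤A ∣B∣≤δ∣A∣)
    δA≤½εA : δ * A ≤ ½ * (ε * A)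
    δA≤½εA = ≤-trans (*-monoʳ-≤-nonNeg A δ≤½ε) (≤-reflexive (*-assoc ½ ε A))
    1≤½εA : 1ℚ ≤ ½ * (ε * A)
    1≤½εA = *-cancelˡ-≤-pos (ι 4) {{ι-pos 3}} (begin
      ι 4 * 1ℚ              ≡⟨ *-identityʳ (ι 4) ⟩
      ι 4                   ≤⟨ 4≤εL ⟩
      ε * L                 ≤⟨ *-monoˡ-≤-nonNeg ε L≤A+δA ⟩
      ε * (A + δ * A)       ≤⟨ *-monoˡ-≤-nonNeg ε (+-monoʳ-≤ A (*-monoʳ-≤-nonNeg A δ≤1)) ⟩
      ε * (A + 1ℚ * A)      ≡⟨ solve 2 (λ e a → e :* (a :+ con 1ℚ :* a) := con (ι 4) :* (con ½ :* (e :* a))) refl ε A ⟩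
      ι 4 * (½ * (ε * A))   ∎)

half≲competitive : ∀ g → Competitive Maj g → LimRatioAtMostOne half g
half≲competitive g (h , h=o[g] , bound) ε 0<ε = 2 ℕ.+ (N₁ ℕ.+ N₂) , eventually
  where
  open ≤-Reasoning
  δ : ℚ
  δ = (½ * ε) ⊓ 1ℚ
  0<δ : 0ℚ < δ
  0<δ = 0<⊓ (positive⁻¹ (½ * ε) {{pos*pos⇒pos ½ ε {{positive 0<ε}}}}) (positive⁻¹ 1ℚ)
  N₁ N₂ : ℕ
  N₁ = proj₁ (h=o[g] δ 0<δ)
  N₂ = proj₁ (archimedean-half 0<ε 4)
  small : ∀ n → N₁ ℕ.≤ n → ∣ h n ∣ ≤ δ * ∣ g n ∣
  small = proj₂ (h=o[g] δ 0<δ)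
  large : ∀ n → N₂ ℕ.≤ n → ι 4 ≤ ε * half n
  large = proj₂ (archimedean-half 0<ε 4)
  half[2]≡1 : half 2 ≡ 1ℚ
  half[2]≡1 = refl

  eventually : ∀ n → 2 ℕ.+ (N₁ ℕ.+ N₂) ℕ.≤ n → half n ≤ (1ℚ + ε) * g n
  eventually (suc (suc n)) (s≤s (s≤s N≤n)) = begin
    half (2 ℕ.+ n)           ≡⟨ half-+ 2 n ⟩
    half 2 + half n          ≡⟨ cong (_+ half n) half[2]≡1 ⟩
    1ℚ + half n              ≤⟨ absorb-perturbation {half n} {g (2 ℕ.+ n)} {h (2 ℕ.+ n)} {δ}
                                  0<ε (p⊓q≤q (½ * ε) 1ℚ) (p⊓q≤p (½ * ε) 1ℚ)
                                  (large n (ℕₚ.m+n≤o⇒n≤o N₁ N≤n)) (half≤g+h {g} {h} bound n)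
                                  (small (2 ℕ.+ n) (ℕₚ.m≤n⇒m≤o+n 2 (ℕₚ.m+n≤o⇒m≤o N₁ N≤n))) ⟩
    (1ℚ + ε) * g (2 ℕ.+ n)   ∎

theorem3 : HasCompetitiveFunction Maj half
theorem3 = Maj-competitive , half≲competitive
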